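{- Let $u$ be a non-empty word in $L_F$ of the form $u=10^{n_k}10^{n_{k-1}}\cdots 10^{n_2}10^{n_1}$ with $k\ge 1$, $n_1\ge 0$ and $n_2,\ldots,n_k>0$. Then $$\#\left\{v\in L_F : \binom{u}{v}>0\right\}=(n_1+2)\prod_{j=2}^{k}(n_j+1).$$
   Context: $L_F=\{\varepsilon\}\cup 1\{0,01\}^*$ is the set of words over $\{0,1\}$ that are empty or start with $1$ and contain no factor $11$. For finite words $u,v$, $\binom{u}{v}$ is the number of occurrences of $v$ as a (scattered) subword (subsequence) of $u$. -}

module Defs where

open import Data.Bool using (Bool; true; false; if_then_else_)
open import Data.Bool.Properties using () renaming (_≟_ to _≟ᵇ_)
open import Data.Nat using (ℕ; zero; suc; _+_)
open import Data.List using (List; []; _∷_; _++_; replicate; reverse; concatMap)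
open import Relation.Nullary using (yes; no)

-- Words over {0,1}: lists of Bool, with false = 0 and true = 1.
Word : Set
Word = List Bool

data Star001 : Word → Set where
  nil  : Star001 []
  ext0  : ∀ {w} → Star001 w → Star001 (false ∷ w)
  ext01 : ∀ {w} → Star001 w → Star001 (false ∷ true ∷ w)

data LF : Word → Set where
  lf-ε : LF []
  lf-1 : ∀ {w} → Star001 w → LF (true ∷ w)

binom : Word → Word → ℕ
binom u       []      = 1
binom []      (_ ∷ _) = 0
binom (a ∷ u) (b ∷ v) with a ≟ᵇ b
... | yes _ = binom u (b ∷ v) + binom u v
... | no  _ = binom u (b ∷ v)

block : ℕ → Word
block n = true ∷ replicate n false

-- u = 1 0^{n_k} 1 0^{n_{k-1}} ... 1 0^{n_2} 1 0^{n_1}, where ns = [n_2, ..., n_k]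
fibWord : ℕ → List ℕ → Word
fibWord n₁ ns = concatMap block (reverse ns) ++ block n₁

-- A subword of u lying in L_F is either ε or 1w with w ∈ {0,01}^*, and such words can be
-- enumerated without repetition by always matching their first letter at its leftmost
-- occurrence in u. Counting the enumeration letter by letter from the right, each block
-- 1 0^c multiplies the count by c + 1, while the last block 1 0^{n₁} contributes n₁ + 2.
module Submission where

open import Defs
open import Data.Bool using (true; false)
open import Data.Bool.Properties using () renaming (_≟_ to _≟ᵇ_)
open import Data.Nat using (ℕ; zero; suc; _*_; _+_; _>_; z≤n; s≤s)
open import Data.Nat.Properties
  using (≤-trans; m≤m+n; m≤n+m; +-comm; +-assoc; +-suc; +-identityʳ; *-comm; *-assoc; *-identityʳ)
open import Data.Nat.ListAction using (product)
open import Data.List using (List; []; _∷_; _++_; [_]; length; map; replicate; reverse; concatMap)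
open import Data.List.Properties
  using (∷-injectiveʳ; length-map; length-++; ++-assoc; ++-identityʳ; concatMap-++; unfold-reverse)
open import Data.List.Membership.Propositional using (_∈_)
open import Data.List.Membership.Propositional.Properties
  using (∈-map⁺; ∈-map⁻; ∈-++⁺ˡ; ∈-++⁺ʳ; ∈-++⁻)
open import Data.List.Relation.Unary.Any using (here; there)
open import Data.List.Relation.Unary.All as All using (All)
import Data.List.Relation.Unary.All.Properties as All
open import Data.List.Relation.Unary.AllPairs using ([]; _∷_)
open import Data.List.Relation.Unary.Unique.Propositional using (Unique)
import Data.List.Relation.Unary.Unique.Propositional.Properties as Unique
open import Data.List.Relation.Binary.Sublist.Propositional using (_⊆_; []; _∷_; _∷ʳ_; minimum)
open import Data.List.Relation.Binary.Sublist.Propositional.Properties using (∷⁻; ∷ʳ⁻)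
open import Data.Product using (Σ; _×_; ∃-syntax; _,_; map₁; map₂)
open import Data.Product.Function.NonDependent.Propositional using (_×-⇔_)
open import Data.Sum using (_⊎_; inj₁; inj₂)
open import Function.Bundles using (_⇔_; mk⇔)
open import Function.Properties.Equivalence using () renaming (refl to ⇔-refl; trans to ⇔-trans)
open import Relation.Nullary using (yes; no; ¬_; contradiction)
open import Relation.Binary.PropositionalEquality
  using (_≡_; refl; cong; cong₂; sym; trans; module ≡-Reasoning)

m+n>0⇒m>0⊎n>0 : ∀ m n → m + n > 0 → m > 0 ⊎ n > 0
m+n>0⇒m>0⊎n>0 zero    n p = inj₂ p
m+n>0⇒m>0⊎n>0 (suc m) n p = inj₁ (s≤s z≤n)

binom-pos⇒⊆ : ∀ u v → binom u v > 0 → v ⊆ u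
binom-pos⇒⊆ u       []      _ = minimum u
binom-pos⇒⊆ (a ∷ u) (b ∷ v) p with a ≟ᵇ b
... | no  _    = a ∷ʳ binom-pos⇒⊆ u (b ∷ v) p
... | yes refl with m+n>0⇒m>0⊎n>0 (binom u (b ∷ v)) (binom u v) p
...   | inj₁ q = a ∷ʳ binom-pos⇒⊆ u (b ∷ v) q
...   | inj₂ q = refl ∷ binom-pos⇒⊆ u v q

⊆⇒binom-pos : ∀ {u v} → v ⊆ u → binom u v > 0
⊆⇒binom-pos []                         = s≤s z≤n
⊆⇒binom-pos {a ∷ u} {[]}    _          = s≤s z≤n
⊆⇒binom-pos {a ∷ u} {b ∷ v} σ with a ≟ᵇ b | σ
... | yes refl | a ∷ʳ τ    = ≤-trans (⊆⇒binom-pos τ) (m≤m+n (binom u (b ∷ v)) (binom u v))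
... | yes refl | refl ∷ τ  = ≤-trans (⊆⇒binom-pos τ) (m≤n+m (binom u v) (binom u (b ∷ v)))
... | no  _    | a ∷ʳ τ    = ⊆⇒binom-pos τ
... | no  a≢b  | refl ∷ _  = contradiction refl a≢b

¬Star001-1∷ : ∀ {w} → ¬ Star001 (true ∷ w)
¬Star001-1∷ ()

starSubwords : Word → List Word
oneSubwords  : Word → List Word
starSubwords []          = [ [] ]
starSubwords (false ∷ u) = [] ∷ map (false ∷_) (starSubwords u ++ oneSubwords u)
starSubwords (true ∷ u)  = starSubwords u
oneSubwords []          = []
oneSubwords (false ∷ u) = oneSubwords u
oneSubwords (true ∷ u)  = map (true ∷_) (starSubwords u)

∈-starSubwords⁻ : ∀ u {w} → w ∈ starSubwords u → Star001 w × w ⊆ u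
∈-oneSubwords⁻  : ∀ u {w} → w ∈ oneSubwords u → ∃[ s ] w ≡ true ∷ s × Star001 s × w ⊆ u
∈-starSubwords⁻ [] (here refl) = nil , []
∈-starSubwords⁻ (false ∷ u) (here refl) = nil , minimum _
∈-starSubwords⁻ (false ∷ u) (there p) with ∈-map⁻ (false ∷_) p
... | s , q , refl = map₂ (refl ∷_) (afterFirst0 (∈-++⁻ (starSubwords u) q))
  where
  afterFirst0 : s ∈ starSubwords u ⊎ s ∈ oneSubwords u → Star001 (false ∷ s) × s ⊆ u
  afterFirst0 (inj₁ r) = map₁ ext0 (∈-starSubwords⁻ u r)
  afterFirst0 (inj₂ r) with ∈-oneSubwords⁻ u r
  ... | _ , refl , star , σ = ext01 star , σ
∈-starSubwords⁻ (true ∷ u) p = map₂ (true ∷ʳ_) (∈-starSubwords⁻ u p)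
∈-oneSubwords⁻ (false ∷ u) p with ∈-oneSubwords⁻ u p
... | s , refl , star , σ = s , refl , star , false ∷ʳ σ
∈-oneSubwords⁻ (true ∷ u) p with ∈-map⁻ (true ∷_) p
... | s , q , refl = s , refl , map₂ (refl ∷_) (∈-starSubwords⁻ u q)

[]∈starSubwords : ∀ u → [] ∈ starSubwords u
[]∈starSubwords []          = here refl
[]∈starSubwords (false ∷ u) = here refl
[]∈starSubwords (true ∷ u)  = []∈starSubwords u

-- Matching the first letter of w at its leftmost occurrence in u loses nothing (∷⁻).
∈-starSubwords⁺ : ∀ u {w} → Star001 w → w ⊆ u → w ∈ starSubwords u
∈-oneSubwords⁺  : ∀ u {s} → Star001 s → true ∷ s ⊆ u → true ∷ s ∈ oneSubwords u
∈-starSubwords⁺ u           nil            _ = []∈starSubwords u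
∈-starSubwords⁺ (false ∷ u) (ext0 star)    σ =
  there (∈-map⁺ (false ∷_) (∈-++⁺ˡ (∈-starSubwords⁺ u star (∷⁻ σ))))
∈-starSubwords⁺ (false ∷ u) (ext01 star)   σ =
  there (∈-map⁺ (false ∷_) (∈-++⁺ʳ (starSubwords u) (∈-oneSubwords⁺ u star (∷⁻ σ))))
∈-starSubwords⁺ (true ∷ u)  star@(ext0 _)  σ = ∈-starSubwords⁺ u star (∷ʳ⁻ (λ ()) σ)
∈-starSubwords⁺ (true ∷ u)  star@(ext01 _) σ = ∈-starSubwords⁺ u star (∷ʳ⁻ (λ ()) σ)
∈-oneSubwords⁺ (false ∷ u) star σ = ∈-oneSubwords⁺ u star (∷ʳ⁻ (λ ()) σ)
∈-oneSubwords⁺ (true ∷ u)  star σ = ∈-map⁺ (true ∷_) (∈-starSubwords⁺ u star (∷⁻ σ))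

lfSubwords : Word → List Word
lfSubwords u = [] ∷ oneSubwords u

∈-lfSubwords : ∀ u v → v ∈ lfSubwords u ⇔ (LF v × v ⊆ u)
∈-lfSubwords u v = mk⇔ to from
  where
  to : v ∈ lfSubwords u → LF v × v ⊆ u
  to (here refl) = lf-ε , minimum u
  to (there p) with ∈-oneSubwords⁻ u p
  ... | s , refl , star , σ = lf-1 star , σ
  from : LF v × v ⊆ u → v ∈ lfSubwords u
  from (lf-ε , _)      = here refl
  from (lf-1 star , σ) = there (∈-oneSubwords⁺ u star σ)

starSubwords-unique : ∀ u → Unique (starSubwords u)
oneSubwords-unique  : ∀ u → Unique (oneSubwords u)
starSubwords-unique []          = All.[] ∷ []
starSubwords-unique (false ∷ u) =
  All.map⁺ (All.universal (λ _ ()) _)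
  ∷ Unique.map⁺ ∷-injectiveʳ
      (Unique.++⁺ (starSubwords-unique u) (oneSubwords-unique u) star∩one≡∅)
  where
  star∩one≡∅ : ∀ {w} → ¬ (w ∈ starSubwords u × w ∈ oneSubwords u)
  star∩one≡∅ (p , q) with ∈-starSubwords⁻ u p | ∈-oneSubwords⁻ u q
  ... | star , _ | _ , refl , _ = ¬Star001-1∷ star
starSubwords-unique (true ∷ u)  = starSubwords-unique u
oneSubwords-unique []          = []
oneSubwords-unique (false ∷ u) = oneSubwords-unique u
oneSubwords-unique (true ∷ u)  = Unique.map⁺ ∷-injectiveʳ (starSubwords-unique u)

lfSubwords-unique : ∀ u → Unique (lfSubwords u)
lfSubwords-unique u = All.tabulate []∉oneSubwords ∷ oneSubwords-unique u
  where
  []∉oneSubwords : ∀ {w} → w ∈ oneSubwords u → ¬ [] ≡ w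
  []∉oneSubwords p with ∈-oneSubwords⁻ u p
  ... | _ , refl , _ = λ ()

oneSubwords-zeros : ∀ c u → oneSubwords (replicate c false ++ u) ≡ oneSubwords u
oneSubwords-zeros zero    u = refl
oneSubwords-zeros (suc c) u = oneSubwords-zeros c u

length-starSubwords-zeros : ∀ c u →
  length (starSubwords (replicate c false ++ u))
    ≡ c * suc (length (oneSubwords u)) + length (starSubwords u)
length-starSubwords-zeros zero    u = refl
length-starSubwords-zeros (suc c) u = begin
  suc (length (map (false ∷_) (S ++ O)))  ≡⟨ cong suc (length-map (false ∷_) (S ++ O)) ⟩
  suc (length (S ++ O))                   ≡⟨ cong suc (length-++ S) ⟩
  suc (length S + length O)               ≡⟨ cong₂ (λ s o → suc (s + length o))
                                               (length-starSubwords-zeros c u) (oneSubwords-zeros c u) ⟩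
  suc (c * suc o + s + o)                 ≡⟨ cong suc (+-comm (c * suc o + s) o) ⟩
  suc o + (c * suc o + s)                 ≡⟨ +-assoc (suc o) (c * suc o) s ⟨
  suc c * suc o + s                       ∎
  where
  open ≡-Reasoning
  S = starSubwords (replicate c false ++ u)
  O = oneSubwords (replicate c false ++ u)
  s = length (starSubwords u)
  o = length (oneSubwords u)

length-lfSubwords-1∷ : ∀ u → length (lfSubwords (true ∷ u)) ≡ suc (length (starSubwords u))
length-lfSubwords-1∷ u = cong suc (length-map (true ∷_) (starSubwords u))

length-lfSubwords-block : ∀ c u →
  length (lfSubwords (block c ++ true ∷ u)) ≡ suc c * length (lfSubwords (true ∷ u))
length-lfSubwords-block c u = begin
  length (lfSubwords (true ∷ replicate c false ++ true ∷ u))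
    ≡⟨ length-lfSubwords-1∷ (replicate c false ++ true ∷ u) ⟩
  suc (length (starSubwords (replicate c false ++ true ∷ u)))
    ≡⟨ cong suc (length-starSubwords-zeros c (true ∷ u)) ⟩
  suc (c * L + length (starSubwords u))
    ≡⟨ cong suc (+-comm (c * L) (length (starSubwords u))) ⟩
  suc (length (starSubwords u)) + c * L
    ≡⟨ cong (_+ c * L) (length-lfSubwords-1∷ u) ⟨
  suc c * L ∎
  where
  open ≡-Reasoning
  L = length (lfSubwords (true ∷ u))

length-lfSubwords-lastBlock : ∀ n → length (lfSubwords (block n)) ≡ n + 2
length-lfSubwords-lastBlock n = begin
  length (lfSubwords (true ∷ replicate n false))
    ≡⟨ length-lfSubwords-1∷ (replicate n false) ⟩
  suc (length (starSubwords (replicate n false)))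
    ≡⟨ cong (λ w → suc (length (starSubwords w))) (++-identityʳ (replicate n false)) ⟨
  suc (length (starSubwords (replicate n false ++ [])))
    ≡⟨ cong suc (length-starSubwords-zeros n []) ⟩
  suc (n * 1 + 1)  ≡⟨ cong (λ m → suc (m + 1)) (*-identityʳ n) ⟩
  suc (n + 1)      ≡⟨ +-suc n 1 ⟨
  n + 2            ∎
  where open ≡-Reasoning

concatMap-reverse-∷ : ∀ {a} {A B : Set a} (f : A → List B) x xs ys →
  concatMap f (reverse (x ∷ xs)) ++ ys ≡ concatMap f (reverse xs) ++ f x ++ ys
concatMap-reverse-∷ f x xs ys = begin
  concatMap f (reverse (x ∷ xs)) ++ ys
    ≡⟨ cong (λ zs → concatMap f zs ++ ys) (unfold-reverse x xs) ⟩
  concatMap f (reverse xs ++ [ x ]) ++ ys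
    ≡⟨ cong (_++ ys) (concatMap-++ f (reverse xs) [ x ]) ⟩
  (concatMap f (reverse xs) ++ f x ++ []) ++ ys
    ≡⟨ ++-assoc (concatMap f (reverse xs)) (f x ++ []) ys ⟩
  concatMap f (reverse xs) ++ (f x ++ []) ++ ys
    ≡⟨ cong (λ zs → concatMap f (reverse xs) ++ zs ++ ys) (++-identityʳ (f x)) ⟩
  concatMap f (reverse xs) ++ f x ++ ys ∎
  where open ≡-Reasoning

length-lfSubwords-blocks : ∀ ns u →
  length (lfSubwords (concatMap block (reverse ns) ++ true ∷ u))
    ≡ product (map suc ns) * length (lfSubwords (true ∷ u))
length-lfSubwords-blocks []       u = sym (+-identityʳ _)
length-lfSubwords-blocks (c ∷ ns) u = begin
  length (lfSubwords (concatMap block (reverse (c ∷ ns)) ++ true ∷ u))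
    ≡⟨ cong (λ w → length (lfSubwords w)) (concatMap-reverse-∷ block c ns (true ∷ u)) ⟩
  length (lfSubwords (concatMap block (reverse ns) ++ block c ++ true ∷ u))
    ≡⟨ length-lfSubwords-blocks ns (replicate c false ++ true ∷ u) ⟩
  P * length (lfSubwords (block c ++ true ∷ u))
    ≡⟨ cong (P *_) (length-lfSubwords-block c u) ⟩
  P * (suc c * L)  ≡⟨ *-assoc P (suc c) L ⟨
  P * suc c * L    ≡⟨ cong (_* L) (*-comm P (suc c)) ⟩
  suc c * P * L    ∎
  where
  open ≡-Reasoning
  P = product (map suc ns)
  L = length (lfSubwords (true ∷ u))

proposition9p6 : (n₁ : ℕ) (ns : List ℕ) → All (λ n → n > 0) ns →
    Σ (List Word) (λ vs → Unique vs
    × ((v : Word) → (v ∈ vs) ⇔ (LF v × binom (fibWord n₁ ns) v > 0))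
    × length vs ≡ (n₁ + 2) * product (map suc ns))
proposition9p6 n₁ ns _ = lfSubwords u , lfSubwords-unique u , membership , count
  where
  u = fibWord n₁ ns
  membership : (v : Word) → (v ∈ lfSubwords u) ⇔ (LF v × binom u v > 0)
  membership v = ⇔-trans (∈-lfSubwords u v)
    (⇔-refl ×-⇔ mk⇔ ⊆⇒binom-pos (binom-pos⇒⊆ u v))
  count : length (lfSubwords u) ≡ (n₁ + 2) * product (map suc ns)
  count = trans (length-lfSubwords-blocks ns (replicate n₁ false))
    (trans (cong (product (map suc ns) *_) (length-lfSubwords-lastBlock n₁))
           (*-comm (product (map suc ns)) (n₁ + 2)))
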